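{- Let $G$ be a finite group and $m$ a positive integer. If $X_I\in\mathcal{D}_m$, then $X_I$ has an option $X_K$ in $\mathcal{D}_{m-1}$, and every option of $X_I$ is in either $\mathcal{D}_m$ or $\mathcal{D}_{m-1}$.
   Context: The positions of $\text{GEN}(G)$ are the non-generating subsets of $G$ (nonterminal) and the generating sets $S$ having some $g\in S$ with $\langle S\setminus\{g\}\rangle\ne G$ (terminal). Let $\mathcal{M}$ be the set of maximal subgroups of $G$ and $\mathcal{I}=\{\cap\mathcal{N}:\emptyset\neq\mathcal{N}\subseteq\mathcal{M}\}$. For $I\in\mathcal{I}$, $X_I$ is the set of subsets of $I$ not contained in any $J\in\mathcal{I}$ with $J\subsetneq I$; $X_G$ is the set of terminal positions. For $I\in\mathcal{I}$ and $K\in\mathcal{I}\cup\{G\}$, $X_K$ is an option of $X_I$ if $I\cup\{g\}\in X_K$ for some $g\in G\setminus I$. The deficiency $\delta(P)$ of $P\subseteq G$ is the minimum size of $Q\subseteq G$ with $\langle P\cup Q\rangle=G$; $\delta(X_I):=\delta(I)$ for $I\in\mathcal{I}\cup\{G\}$. $\mathcal{D}_m$ is the set of structure classes $X_I$, $I\in\mathcal{I}\cup\{G\}$, with $\delta(X_I)=m$. -}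

module Defs where

open import Data.Nat using (ℕ; _≤_)
open import Data.Fin using (Fin)
open import Data.Fin.Subset using (Subset; _∈_; _∉_; _⊆_; _⊂_; _∩_; _∪_; _-_; ⁅_⁆; ∣_∣; ⊤)
open import Data.List using (List; foldr)
open import Data.List.Relation.Unary.All using (All)
open import Data.Product using (Σ; _×_; ∃; ∃-syntax)
open import Data.Sum using (_⊎_)
open import Relation.Nullary using (¬_)
open import Relation.Binary.PropositionalEquality using (_≡_)
open import Algebra.Core using (Op₁; Op₂)
open import Algebra.Structures using (IsGroup)

-- A finite group: a group structure on the finite set Fin n
-- (every finite group is isomorphic to one of this form).
record FiniteGroup : Set where
  field
    n       : ℕ
    _∙_     : Op₂ (Fin n)
    ε       : Fin n
    _⁻¹     : Op₁ (Fin n)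
    isGroup : IsGroup _≡_ _∙_ ε _⁻¹

module _ (G : FiniteGroup) where
  open FiniteGroup G

  Sub : Set
  Sub = Subset n

  IsSubgroup : Sub → Set
  IsSubgroup H = (ε ∈ H)
               × (∀ x y → x ∈ H → y ∈ H → (x ∙ y) ∈ H)
               × (∀ x → x ∈ H → (x ⁻¹) ∈ H)

  Generates : Sub → Set
  Generates S = ∀ H → IsSubgroup H → S ⊆ H → ∀ x → x ∈ H

  IsMaximal : Sub → Set
  IsMaximal M = IsSubgroup M
              × (∃[ x ] x ∉ M)
              × (∀ H → IsSubgroup H → M ⊆ H → H ⊆ M ⊎ (∀ x → x ∈ H))

  -- 𝓘 : intersections of nonempty families of maximal subgroups
  InI : Sub → Set
  InI I = Σ Sub λ M → Σ (List Sub) λ Ms →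
            IsMaximal M × All IsMaximal Ms × (I ≡ foldr _∩_ M Ms)

  Terminal : Sub → Set
  Terminal S = Generates S × (∃[ g ] (g ∈ S × ¬ Generates (S - g)))

  -- indices of structure classes: I ∈ 𝓘, or G itself
  data Index : Set where
    idx : (I : Sub) → InI I → Index
    top : Index

  carrier : Index → Sub
  carrier (idx I _) = I
  carrier top       = ⊤

  _∈X_ : Sub → Index → Set
  P ∈X idx I _ = P ⊆ I × (∀ J → InI J → J ⊂ I → ¬ (P ⊆ J))
  P ∈X top     = Terminal P

  IsOption : Index → Index → Set
  IsOption i k = ∃[ g ] (g ∉ carrier i × (carrier i ∪ ⁅ g ⁆) ∈X k)

  Deficiency : Sub → ℕ → Set
  Deficiency P d = (∃[ Q ] (∣ Q ∣ ≡ d × Generates (P ∪ Q)))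
                 × (∀ Q → Generates (P ∪ Q) → d ≤ ∣ Q ∣)

  InD : ℕ → Index → Set
  InD m k = Deficiency (carrier k) m

-- Adding one element g to a set P lowers its deficiency by at
-- most one: a generating complement Q of P ∪ {g} gives the complement Q ∪ {g} of P. And if P
-- lies in the class X_K, then every maximal subgroup containing P contains K, so P ∪ Q and
-- K ∪ Q lie in the same maximal subgroups; since a subset of a finite group generates iff it
-- lies in no maximal subgroup, P and K have the same generating complements and δ(P) = δ(K);
-- terminal positions generate, so there δ(P) = 0 = δ(G).
-- For the option of deficiency m - 1, remove one element g of a minimum generating complement
-- of I; then g ∉ I and δ(I ∪ {g}) = m - 1, and I ∪ {g} is terminal if it generates and
-- otherwise lies in the class of the intersection of the maximal subgroups containing it.
module Submission where

open import Defs
open import Data.Nat using (ℕ; _≤_; _<_; _∸_; _+_; z≤n; s≤s; _≤?_)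
open import Data.Nat.Properties
  using (≤-trans; ≤-reflexive; ≤-antisym; +-monoʳ-≤; +-suc; n≤1+n; n≤0⇒n≡0; m≤n+o⇒m∸n≤o; m+n≤o⇒m≤o∸n; m≤n+m∸n; +-comm; ≰⇒>; <⇒≢; <⇒≱; module ≤-Reasoning)
open import Data.Nat.Induction using (<-wellFounded)
open import Data.Fin using (_≟_)
open import Data.Fin.Properties using (all?; any?)
open import Data.Fin.Subset
  using (Subset; _∈_; _∉_; _⊆_; _⊂_; _⊃_; _∩_; _∪_; _-_; _─_; ⁅_⁆; ∣_∣; ⊤; ∁) renaming (⊥ to ∅)
open import Data.Fin.Subset.Properties
  using (_∈?_; _⊆?_; anySubset?; nonempty?; Empty-unique; ⊆-refl; ⊆-trans; ∈⊤; x∈⁅x⁆; x∈⁅y⁆⇒x≡y;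
         x∈p∩q⁺; p∩q⊆p; p∩q⊆q; x∈p∪q⁻; p⊆p∪q; q⊆p∪q; ∪-assoc; p─q⊆p; x∈p∧x≢y⇒x∈p-y;
         ∣⊥∣≡0; ∣⁅x⁆∣≡1; p⊂q⇒∣p∣<∣q∣; p⊂q⇒∁p⊃∁q; x∈p⇒∣p-x∣<∣p∣)
open import Data.Bool using (true; false)
open import Data.Vec using ([]; _∷_; here; there)
open import Data.Product using (Σ; _×_; _,_; proj₁; proj₂; ∃-syntax)
open import Data.Sum as Sum using (_⊎_; inj₁; inj₂; [_,_]′)
open import Data.List using ([]; _∷_; foldr)
open import Data.List.Relation.Unary.All using (All; []; _∷_)
open import Data.Empty using (⊥-elim)
open import Function using (_∘_)
open import Induction.WellFounded using (WellFounded; Acc; acc; module Subrelation)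
import Relation.Binary.Construct.On as On
open import Relation.Nullary using (¬_; Dec; yes; no; contradiction)
open import Relation.Nullary.Decidable using (_×-dec_; _→-dec_; ¬?; map′; decidable-stable)
open import Relation.Binary.PropositionalEquality using (_≡_; refl; sym; trans; cong; subst)

∣p∪q∣≤∣p∣+∣q∣ : ∀ {k} (p q : Subset k) → ∣ p ∪ q ∣ ≤ ∣ p ∣ + ∣ q ∣
∣p∪q∣≤∣p∣+∣q∣ []          []          = z≤n
∣p∪q∣≤∣p∣+∣q∣ (true ∷ p)  (true ∷ q)  = s≤s (≤-trans (∣p∪q∣≤∣p∣+∣q∣ p q) (+-monoʳ-≤ ∣ p ∣ (n≤1+n _)))
∣p∪q∣≤∣p∣+∣q∣ (true ∷ p)  (false ∷ q) = s≤s (∣p∪q∣≤∣p∣+∣q∣ p q)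
∣p∪q∣≤∣p∣+∣q∣ (false ∷ p) (true ∷ q)  = ≤-trans (s≤s (∣p∪q∣≤∣p∣+∣q∣ p q)) (≤-reflexive (sym (+-suc ∣ p ∣ ∣ q ∣)))
∣p∪q∣≤∣p∣+∣q∣ (false ∷ p) (false ∷ q) = ∣p∪q∣≤∣p∣+∣q∣ p q

∪-lub : ∀ {k} {p q r : Subset k} → p ⊆ r → q ⊆ r → p ∪ q ⊆ r
∪-lub {p = p} {q} p⊆r q⊆r x∈p∪q = [ p⊆r , q⊆r ]′ (x∈p∪q⁻ p q x∈p∪q)

∪-monoˡ : ∀ {k} {p p′ : Subset k} (q : Subset k) → p ⊆ p′ → p ∪ q ⊆ p′ ∪ q
∪-monoˡ {p′ = p′} q p⊆p′ = ∪-lub (⊆-trans p⊆p′ (p⊆p∪q q)) (q⊆p∪q p′ q)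

⊆-∩ : ∀ {k} {p q r : Subset k} → p ⊆ q → p ⊆ r → p ⊆ q ∩ r
⊆-∩ p⊆q p⊆r x∈p = x∈p∩q⁺ (p⊆q x∈p , p⊆r x∈p)

x∈p⇒⁅x⁆⊆p : ∀ {k} {p : Subset k} {x} → x ∈ p → ⁅ x ⁆ ⊆ p
x∈p⇒⁅x⁆⊆p {p = p} {x} x∈p y∈⁅x⁆ = subst (_∈ p) (sym (x∈⁅y⁆⇒x≡y x y∈⁅x⁆)) x∈p

x∈p─q⇒x∉q : ∀ {k} (p q : Subset k) {x} → x ∈ p ─ q → x ∉ q
x∈p─q⇒x∉q (true ∷ p)  (.true ∷ q) ()            here
x∈p─q⇒x∉q (false ∷ p) (.true ∷ q) ()            here
x∈p─q⇒x∉q (_ ∷ p)     (_ ∷ q)     (there x∈p─q) (there x∈q) = x∈p─q⇒x∉q p q x∈p─q x∈q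

p⊆p-x∪⁅x⁆ : ∀ {k} (p : Subset k) x → p ⊆ (p - x) ∪ ⁅ x ⁆
p⊆p-x∪⁅x⁆ p x {y} y∈p with y ≟ x
... | yes refl = q⊆p∪q (p - x) ⁅ x ⁆ (x∈⁅x⁆ x)
... | no y≢x   = p⊆p∪q ⁅ x ⁆ (x∈p∧x≢y⇒x∈p-y y∈p y≢x)

p∪⁅x⁆-x⊆p : ∀ {k} (p : Subset k) x → (p ∪ ⁅ x ⁆) - x ⊆ p
p∪⁅x⁆-x⊆p p x y∈ =
  [ (λ y∈p → y∈p) , (λ y∈⁅x⁆ → ⊥-elim (x∈p─q⇒x∉q (p ∪ ⁅ x ⁆) ⁅ x ⁆ y∈ y∈⁅x⁆)) ]′
    (x∈p∪q⁻ p ⁅ x ⁆ (p─q⊆p (p ∪ ⁅ x ⁆) ⁅ x ⁆ y∈))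

p⊈q⇒∃∈p∉q : ∀ {k} {p q : Subset k} → ¬ p ⊆ q → ∃[ x ] (x ∈ p × x ∉ q)
p⊈q⇒∃∈p∉q {p = p} {q} p⊈q =
  decidable-stable (any? (λ x → (x ∈? p) ×-dec ¬? (x ∈? q)))
    λ ∄ → p⊈q λ {x} x∈p → decidable-stable (x ∈? q) λ x∉q → ∄ (x , x∈p , x∉q)

⊂-wellFounded : ∀ {k} → WellFounded (_⊂_ {k})
⊂-wellFounded = Subrelation.wellFounded p⊂q⇒∣p∣<∣q∣ (On.wellFounded ∣_∣ <-wellFounded)

⊃-wellFounded : ∀ {k} → WellFounded (_⊃_ {k})
⊃-wellFounded = Subrelation.wellFounded (p⊂q⇒∣p∣<∣q∣ ∘ p⊂q⇒∁p⊃∁q) (On.wellFounded (∣_∣ ∘ ∁) <-wellFounded)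

module _ (G : FiniteGroup) where
  open FiniteGroup G

  Generates-mono : ∀ {S T} → S ⊆ T → Generates G S → Generates G T
  Generates-mono S⊆T gen H H≤G T⊆H = gen H H≤G (⊆-trans S⊆T T⊆H)

  generates-⊤ : Generates G ⊤
  generates-⊤ H _ ⊤⊆H x = ⊤⊆H ∈⊤

  isSubgroup? : ∀ H → Dec (IsSubgroup G H)
  isSubgroup? H =
    (ε ∈? H)
    ×-dec all? (λ x → all? λ y → (x ∈? H) →-dec (y ∈? H) →-dec ((x ∙ y) ∈? H))
    ×-dec all? (λ x → (x ∈? H) →-dec ((x ⁻¹) ∈? H))

  ProperSubgroupOver : Sub G → Sub G → Set
  ProperSubgroupOver S H = IsSubgroup G H × S ⊆ H × ∃[ x ] x ∉ H

  properSubgroupOver? : ∀ S H → Dec (ProperSubgroupOver S H)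
  properSubgroupOver? S H = isSubgroup? H ×-dec (S ⊆? H) ×-dec any? (λ x → ¬? (x ∈? H))

  noProperSubgroupOver⇒generates : ∀ {S} → ¬ (∃[ H ] ProperSubgroupOver S H) → Generates G S
  noProperSubgroupOver⇒generates ∄ H H≤G S⊆H x =
    decidable-stable (x ∈? H) λ x∉H → ∄ (H , H≤G , S⊆H , x , x∉H)

  generates? : ∀ S → Dec (Generates G S)
  generates? S =
    map′ noProperSubgroupOver⇒generates
         (λ { gen (H , H≤G , S⊆H , x , x∉H) → x∉H (gen H H≤G S⊆H x) })
         (¬? (anySubset? (properSubgroupOver? S)))

  ProperSubgroupAbove : Sub G → Sub G → Set
  ProperSubgroupAbove M H = ProperSubgroupOver M H × ¬ H ⊆ M

  properSubgroupAbove? : ∀ M H → Dec (ProperSubgroupAbove M H)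
  properSubgroupAbove? M H = properSubgroupOver? M H ×-dec ¬? (H ⊆? M)

  noProperSubgroupAbove⇒maximal : ∀ {M} → IsSubgroup G M → ∃[ x ] x ∉ M →
                                  ¬ (∃[ H ] ProperSubgroupAbove M H) → IsMaximal G M
  noProperSubgroupAbove⇒maximal {M} M≤G M-proper ∄ = M≤G , M-proper , maximality
    where
    maximality : ∀ H → IsSubgroup G H → M ⊆ H → H ⊆ M ⊎ (∀ x → x ∈ H)
    maximality H H≤G M⊆H with H ⊆? M
    ... | yes H⊆M = inj₁ H⊆M
    ... | no H⊈M  = inj₂ λ x → decidable-stable (x ∈? H) λ x∉H → ∄ (H , (H≤G , M⊆H , x , x∉H) , H⊈M)

  maximal⇒noProperSubgroupAbove : ∀ {M} → IsMaximal G M → ¬ (∃[ H ] ProperSubgroupAbove M H)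
  maximal⇒noProperSubgroupAbove (_ , _ , maximality) (H , (H≤G , M⊆H , x , x∉H) , H⊈M)
    with maximality H H≤G M⊆H
  ... | inj₁ H⊆M = H⊈M H⊆M
  ... | inj₂ H≡G = x∉H (H≡G x)

  isMaximal? : ∀ M → Dec (IsMaximal G M)
  isMaximal? M =
    map′ (λ { (M≤G , M-proper , ∄) → noProperSubgroupAbove⇒maximal M≤G M-proper ∄ })
         (λ M-max → proj₁ M-max , proj₁ (proj₂ M-max) , maximal⇒noProperSubgroupAbove M-max)
         (isSubgroup? M ×-dec any? (λ x → ¬? (x ∈? M)) ×-dec ¬? (anySubset? (properSubgroupAbove? M)))

  properSubgroup⊆maximal : ∀ {H} → IsSubgroup G H → ∃[ x ] x ∉ H → ∃[ M ] (IsMaximal G M × H ⊆ M)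
  properSubgroup⊆maximal {H} = go H (⊃-wellFounded H)
    where
    go : ∀ H → Acc _⊃_ H → IsSubgroup G H → ∃[ x ] x ∉ H → ∃[ M ] (IsMaximal G M × H ⊆ M)
    go H (acc above) H≤G H-proper with anySubset? (properSubgroupAbove? H)
    ... | no ∄ = H , noProperSubgroupAbove⇒maximal H≤G H-proper ∄ , ⊆-refl
    ... | yes (H′ , (H′≤G , H⊆H′ , H′-proper) , H′⊈H)
      with go H′ (above (H⊆H′ , p⊈q⇒∃∈p∉q H′⊈H)) H′≤G H′-proper
    ...   | M , M-max , H′⊆M = M , M-max , ⊆-trans H⊆H′ H′⊆M

  ¬generates⇒⊆maximal : ∀ {S} → ¬ Generates G S → ∃[ M ] (IsMaximal G M × S ⊆ M)
  ¬generates⇒⊆maximal {S} ¬gen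
    with decidable-stable (anySubset? (properSubgroupOver? S)) (¬gen ∘ noProperSubgroupOver⇒generates)
  ... | H , H≤G , S⊆H , H-proper with properSubgroup⊆maximal H≤G H-proper
  ...   | M , M-max , H⊆M = M , M-max , ⊆-trans S⊆H H⊆M

  InEveryMaximalOver : Sub G → Sub G → Set
  InEveryMaximalOver P K = ∀ M → IsMaximal G M → P ⊆ M → K ⊆ M

  InEveryMaximalOver-∪ : ∀ {P K} Q → InEveryMaximalOver P K → InEveryMaximalOver (P ∪ Q) (K ∪ Q)
  InEveryMaximalOver-∪ {P} Q P≺K M M-max P∪Q⊆M =
    ∪-lub (P≺K M M-max (⊆-trans (p⊆p∪q Q) P∪Q⊆M)) (⊆-trans (q⊆p∪q P Q) P∪Q⊆M)

  maximal⇒¬generates : ∀ {M S} → IsMaximal G M → S ⊆ M → ¬ Generates G S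
  maximal⇒¬generates (M≤G , (x , x∉M) , _) S⊆M gen = x∉M (gen _ M≤G S⊆M x)

  InEveryMaximalOver⇒generates : ∀ {S T} → InEveryMaximalOver S T → Generates G T → Generates G S
  InEveryMaximalOver⇒generates {S} S≺T genT = decidable-stable (generates? S) λ ¬genS →
    let (M , M-max , S⊆M) = ¬generates⇒⊆maximal ¬genS
    in maximal⇒¬generates M-max (S≺T M M-max S⊆M) genT

  Deficiency-intro : ∀ {P d} Q → ∣ Q ∣ ≤ d → Generates G (P ∪ Q) →
                     (∀ Q′ → Generates G (P ∪ Q′) → d ≤ ∣ Q′ ∣) → Deficiency G P d
  Deficiency-intro Q ∣Q∣≤d gen minimal = (Q , ≤-antisym ∣Q∣≤d (minimal Q gen) , gen) , minimal

  Deficiency-cong : ∀ {P K d} →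
                    (∀ Q → Generates G (P ∪ Q) → Generates G (K ∪ Q)) →
                    (∀ Q → Generates G (K ∪ Q) → Generates G (P ∪ Q)) →
                    Deficiency G P d → Deficiency G K d
  Deficiency-cong P⇒K K⇒P ((Q , ∣Q∣≡d , gen) , minimal) = (Q , ∣Q∣≡d , P⇒K Q gen) , λ Q′ → minimal Q′ ∘ K⇒P Q′

  Deficiency-transfer : ∀ {P K d} → P ⊆ K → InEveryMaximalOver P K → Deficiency G P d → Deficiency G K d
  Deficiency-transfer P⊆K P≺K =
    Deficiency-cong (λ Q → Generates-mono (∪-monoˡ Q P⊆K))
                    (λ Q → InEveryMaximalOver⇒generates (InEveryMaximalOver-∪ Q P≺K))

  generates⇒Deficiency0 : ∀ {P} → Generates G P → Deficiency G P 0
  generates⇒Deficiency0 gen = (∅ , ∣⊥∣≡0 n , Generates-mono (p⊆p∪q ∅) gen) , λ _ _ → z≤n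

  generates⇒deficiency≡0 : ∀ {P d} → Generates G P → Deficiency G P d → d ≡ 0
  generates⇒deficiency≡0 gen (_ , minimal) =
    n≤0⇒n≡0 (≤-trans (minimal ∅ (Generates-mono (p⊆p∪q ∅) gen)) (≤-reflexive (∣⊥∣≡0 n)))

  positiveDeficiency⇒¬generates : ∀ {P m} → 1 ≤ m → Deficiency G P m → ¬ Generates G P
  positiveDeficiency⇒¬generates 1≤m δ gen = <⇒≢ 1≤m (sym (generates⇒deficiency≡0 gen δ))

  deficiency-∪⁅⁆-lowerBound : ∀ {P m} → Deficiency G P m →
                              ∀ g Q → Generates G ((P ∪ ⁅ g ⁆) ∪ Q) → m ∸ 1 ≤ ∣ Q ∣
  deficiency-∪⁅⁆-lowerBound {P} {m} (_ , minimal) g Q gen = m≤n+o⇒m∸n≤o m 1 (begin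
    m                    ≤⟨ minimal (⁅ g ⁆ ∪ Q) (subst (Generates G) (∪-assoc P ⁅ g ⁆ Q) gen) ⟩
    ∣ ⁅ g ⁆ ∪ Q ∣        ≤⟨ ∣p∪q∣≤∣p∣+∣q∣ ⁅ g ⁆ Q ⟩
    ∣ ⁅ g ⁆ ∣ + ∣ Q ∣    ≡⟨ cong (_+ ∣ Q ∣) (∣⁅x⁆∣≡1 g) ⟩
    1 + ∣ Q ∣            ∎)
    where open ≤-Reasoning

  deficiency-∪⁅⁆ : ∀ {P m} → Deficiency G P m →
                   ∀ g → Deficiency G (P ∪ ⁅ g ⁆) m ⊎ Deficiency G (P ∪ ⁅ g ⁆) (m ∸ 1)
  deficiency-∪⁅⁆ {P} {m} δ@((Q , ∣Q∣≡m , gen) , _) g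
    with anySubset? (λ Q′ → (∣ Q′ ∣ ≤? m ∸ 1) ×-dec generates? ((P ∪ ⁅ g ⁆) ∪ Q′))
  ... | yes (Q′ , ∣Q′∣≤ , gen′) = inj₂ (Deficiency-intro Q′ ∣Q′∣≤ gen′ (deficiency-∪⁅⁆-lowerBound δ g))
  ... | no ∄ = inj₁ ((Q , ∣Q∣≡m , Generates-mono (∪-monoˡ Q (p⊆p∪q ⁅ g ⁆)) gen) , minimal)
    where
    minimal : ∀ Q′ → Generates G ((P ∪ ⁅ g ⁆) ∪ Q′) → m ≤ ∣ Q′ ∣
    minimal Q′ gen′ = ≤-trans (m≤n+m∸n m 1) (≰⇒> λ ∣Q′∣≤ → ∄ (Q′ , ∣Q′∣≤ , gen′))

  deficiency-drop : ∀ {P m} → 1 ≤ m → Deficiency G P m → ∃[ g ] (g ∉ P × Deficiency G (P ∪ ⁅ g ⁆) (m ∸ 1))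
  deficiency-drop {P} {m} 1≤m δ@((Q , ∣Q∣≡m , gen) , minimal) with nonempty? Q
  ... | no Q-empty = contradiction (trans (sym ∣Q∣≡m) (trans (cong ∣_∣ (Empty-unique Q-empty)) (∣⊥∣≡0 n)))
                                   (<⇒≢ 1≤m ∘ sym)
  ... | yes (g , g∈Q) = g , g∉P , Deficiency-intro (Q - g) ∣Q-g∣≤m∸1 gen′ (deficiency-∪⁅⁆-lowerBound δ g)
    where
    ∣Q-g∣<m : ∣ Q - g ∣ < m
    ∣Q-g∣<m = subst (∣ Q - g ∣ <_) ∣Q∣≡m (x∈p⇒∣p-x∣<∣p∣ g∈Q)
    ∣Q-g∣≤m∸1 : ∣ Q - g ∣ ≤ m ∸ 1
    ∣Q-g∣≤m∸1 = m+n≤o⇒m≤o∸n ∣ Q - g ∣ (subst (_≤ m) (+-comm 1 ∣ Q - g ∣) ∣Q-g∣<m)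
    gen′ : Generates G ((P ∪ ⁅ g ⁆) ∪ (Q - g))
    gen′ = Generates-mono (∪-lub (⊆-trans (p⊆p∪q ⁅ g ⁆) (p⊆p∪q (Q - g)))
                                 (⊆-trans (p⊆p-x∪⁅x⁆ Q g) (∪-lub (q⊆p∪q _ (Q - g)) (⊆-trans (q⊆p∪q P ⁅ g ⁆) (p⊆p∪q (Q - g))))))
                          gen
    g∉P : g ∉ P
    g∉P g∈P = <⇒≱ ∣Q-g∣<m (minimal (Q - g) (Generates-mono (∪-monoˡ (Q - g) (∪-lub ⊆-refl (x∈p⇒⁅x⁆⊆p g∈P))) gen′))

  ∈X⇒InEveryMaximalOver : ∀ {P K} (K∈𝓘 : InI G K) → _∈X_ G P (idx K K∈𝓘) → InEveryMaximalOver P K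
  ∈X⇒InEveryMaximalOver {P} {K} (M₀ , Ms , M₀-max , Ms-max , refl) (P⊆K , K-minimal) M M-max P⊆M =
    decidable-stable (K ⊆? M) λ K⊈M →
      let (x , x∈K , x∉M) = p⊈q⇒∃∈p∉q K⊈M
      in K-minimal (M ∩ K) (M₀ , M ∷ Ms , M₀-max , M-max ∷ Ms-max , refl)
                   (p∩q⊆q M K , x , x∈K , x∉M ∘ p∩q⊆p M K)
                   (⊆-∩ P⊆M P⊆K)

  InEveryMaximalOver⇒⊆⋂ : ∀ {P K M} Ms → InEveryMaximalOver P K → IsMaximal G M → All (IsMaximal G) Ms →
                           P ⊆ foldr _∩_ M Ms → K ⊆ foldr _∩_ M Ms
  InEveryMaximalOver⇒⊆⋂ {M = M} []        P≺K M-max []               P⊆M = P≺K M M-max P⊆M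
  InEveryMaximalOver⇒⊆⋂ {M = M} (M′ ∷ Ms) P≺K M-max (M′-max ∷ Ms-max) P⊆⋂ =
    ⊆-∩ (P≺K M′ M′-max (⊆-trans P⊆⋂ (p∩q⊆p M′ _)))
        (InEveryMaximalOver⇒⊆⋂ Ms P≺K M-max Ms-max (⊆-trans P⊆⋂ (p∩q⊆q M′ _)))

  InEveryMaximalOver⇒∈X : ∀ {P K} (K∈𝓘 : InI G K) → P ⊆ K → InEveryMaximalOver P K → _∈X_ G P (idx K K∈𝓘)
  InEveryMaximalOver⇒∈X K∈𝓘 P⊆K P≺K =
    P⊆K , λ { J (M , Ms , M-max , Ms-max , refl) (_ , x , x∈K , x∉J) P⊆J →
                x∉J (InEveryMaximalOver⇒⊆⋂ Ms P≺K M-max Ms-max P⊆J x∈K) }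

  -- The class of P is that of the intersection of all maximal subgroups containing P, reached
  -- by cutting K down by a maximal subgroup over P that misses part of K, as long as one exists.
  ¬generates⇒∈X : ∀ {P} → ¬ Generates G P → ∃[ K ] Σ (InI G K) λ K∈𝓘 → _∈X_ G P (idx K K∈𝓘)
  ¬generates⇒∈X {P} ¬gen =
    let (M , M-max , P⊆M) = ¬generates⇒⊆maximal ¬gen
    in shrink M (⊂-wellFounded M) (M , [] , M-max , [] , refl) P⊆M
    where
    shrink : ∀ K → Acc _⊂_ K → InI G K → P ⊆ K → ∃[ K ] Σ (InI G K) λ K∈𝓘 → _∈X_ G P (idx K K∈𝓘)
    shrink K (acc below) K∈𝓘@(M₀ , Ms , M₀-max , Ms-max , refl) P⊆K
      with anySubset? (λ M → isMaximal? M ×-dec (P ⊆? M) ×-dec ¬? (K ⊆? M))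
    ... | yes (M , M-max , P⊆M , K⊈M) =
      let (x , x∈K , x∉M) = p⊈q⇒∃∈p∉q K⊈M
      in shrink (M ∩ K) (below (p∩q⊆q M K , x , x∈K , x∉M ∘ p∩q⊆p M K))
                (M₀ , M ∷ Ms , M₀-max , M-max ∷ Ms-max , refl) (⊆-∩ P⊆M P⊆K)
    ... | no ∄ = K , K∈𝓘 , InEveryMaximalOver⇒∈X K∈𝓘 P⊆K λ M M-max P⊆M →
                   decidable-stable (K ⊆? M) λ K⊈M → ∄ (M , M-max , P⊆M , K⊈M)

  ∪⁅⁆-∈X : ∀ {I} → ¬ Generates G I → ∀ g → ∃[ k ] _∈X_ G (I ∪ ⁅ g ⁆) k
  ∪⁅⁆-∈X {I} ¬genI g with generates? (I ∪ ⁅ g ⁆)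
  ... | yes gen = top , gen , g , q⊆p∪q I ⁅ g ⁆ (x∈⁅x⁆ g) , ¬genI ∘ Generates-mono (p∪⁅x⁆-x⊆p I g)
  ... | no ¬gen = let (K , K∈𝓘 , P∈X) = ¬generates⇒∈X ¬gen in idx K K∈𝓘 , P∈X

  ∈X⇒Deficiency : ∀ {P d} k → _∈X_ G P k → Deficiency G P d → Deficiency G (carrier G k) d
  ∈X⇒Deficiency (idx K K∈𝓘) P∈X = Deficiency-transfer (proj₁ P∈X) (∈X⇒InEveryMaximalOver K∈𝓘 P∈X)
  ∈X⇒Deficiency top (gen , _) δ =
    subst (Deficiency G ⊤) (sym (generates⇒deficiency≡0 gen δ)) (generates⇒Deficiency0 generates-⊤)

proposition3p8 : (G : FiniteGroup) (m : ℕ) → 1 ≤ m → (i : Index G) → InD G m i →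
    (∃[ k ] (IsOption G i k × InD G (m ∸ 1) k))
    × (∀ k → IsOption G i k → InD G m k ⊎ InD G (m ∸ 1) k)
proposition3p8 G m 1≤m top δ = ⊥-elim (positiveDeficiency⇒¬generates G 1≤m δ (generates-⊤ G))
proposition3p8 G m 1≤m i@(idx I _) δ = optionDown , optionsSameOrDown
  where
  optionDown : ∃[ k ] (IsOption G i k × InD G (m ∸ 1) k)
  optionDown =
    let (g , g∉I , δ′) = deficiency-drop G 1≤m δ
        (k , I∪g∈X)   = ∪⁅⁆-∈X G (positiveDeficiency⇒¬generates G 1≤m δ) g
    in k , (g , g∉I , I∪g∈X) , ∈X⇒Deficiency G k I∪g∈X δ′

  optionsSameOrDown : ∀ k → IsOption G i k → InD G m k ⊎ InD G (m ∸ 1) k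
  optionsSameOrDown k (g , _ , I∪g∈X) =
    Sum.map (∈X⇒Deficiency G k I∪g∈X) (∈X⇒Deficiency G k I∪g∈X) (deficiency-∪⁅⁆ G δ g)
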